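{- In $\mathrm{PL}(\mathrm{NE})$, the following are equivalent: (i) $\phi$ and $\psi$ are ground-complementary modulo $\bot\wedge\mathrm{NE}$; (ii) there is a formula $\theta$ such that $\phi\equiv \theta$ and $\psi \equiv \neg \theta$ (and $\mathsf{P}(\theta)= \mathsf{P}(\phi)\cup \mathsf{P}(\psi)$).
   Context: $\mathrm{PL}(\mathrm{NE})$: $\phi ::= p \mid \bot \mid \neg\phi \mid \phi\wedge\phi \mid \phi\vee\phi \mid \mathrm{NE}$, on propositional teams with support $\models$ / anti-support $\models^-$: $p$ supported iff all $w\in s$ make $p$ true, anti-supported iff none do; $s\models\bot$ iff $s=\emptyset$, $\bot$ always anti-supported; $s\models\mathrm{NE}$ iff $s\ne\emptyset$, $s\models^-\mathrm{NE}$ iff $s=\emptyset$; $\neg$ swaps support and anti-support; $\wedge$ supported iff both conjuncts are, anti-supported iff $s=t\cup u$ with $t\models^-\phi,u\models^-\psi$; $\vee$ supported iff $s=t\cup u$ with $t\models\phi,u\models\psi$, anti-supported iff both are. $\top:=\neg\bot$. Ground team $|\phi|_\mathsf{X}$: valuations over $\mathsf{X}$ belonging to some team over $\mathsf{X}$ supporting $\phi$. $\phi,\psi$ are ground-complementary modulo $\bot\wedge\mathrm{NE}$ if (a) $|\phi|_\mathsf{X}=|\top|_\mathsf{X}\setminus|\psi|_\mathsf{X}$ and $|\psi|_\mathsf{X}=|\top|_\mathsf{X}\setminus|\phi|_\mathsf{X}$ for all $\mathsf{X}\supseteq\mathsf{P}(\phi)\cup\mathsf{P}(\psi)$, or (b)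 $\phi\equiv\bot\wedge\mathrm{NE}$, or (c) $\psi\equiv\bot\wedge\mathrm{NE}$ ($\bot\wedge\mathrm{NE}$ is supported by no team). -}

module Defs where

open import Data.Nat using (ℕ; _≟_)
open import Data.Bool using (Bool; true; false; if_then_else_; _∨_)
open import Data.List using (List; []; _∷_; _++_; length)
open import Data.List.Membership.Propositional using (_∈_)
open import Data.List.Relation.Binary.Subset.Propositional using (_⊆_)
open import Data.List.Relation.Unary.Unique.Propositional using (Unique)
open import Data.Vec using (Vec; []; _∷_)
open import Data.Product using (Σ; _×_; ∃; ∃-syntax)
open import Data.Sum using (_⊎_)
open import Data.Unit using (⊤)
open import Relation.Nullary using (¬_; does)
open import Relation.Binary.PropositionalEquality using (_≡_)
open import Function.Bundles using (_⇔_)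

data Form : Set where
  var  : ℕ → Form
  bot  : Form
  neg  : Form → Form
  _and_ : Form → Form → Form
  _or_  : Form → Form → Form
  NE   : Form

top : Form
top = neg bot

P : Form → List ℕ
P (var p)   = p ∷ []
P bot       = []
P (neg φ)   = P φ
P (φ and ψ) = P φ ++ P ψ
P (φ or ψ)  = P φ ++ P ψ
P NE        = []

-- A finite set of variables X is a duplicate-free list; a valuation over X
-- assigns a truth value to each element of X (in order).
Val : List ℕ → Set
Val X = Vec Bool (length X)

-- the truth value of variable p under valuation w over X
-- (false if p ∉ X; only used for p ∈ X)
val : (X : List ℕ) → Val X → ℕ → Bool
val []      []      p = false
val (x ∷ X) (b ∷ w) p = if does (x ≟ p) then b else val X w p

Team : List ℕ → Set
Team X = Val X → Bool

_∈T_ : {X : List ℕ} → Val X → Team X → Set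
_∈T_ {X} w s = s w ≡ true

IsUnion : (X : List ℕ) → Team X → Team X → Team X → Set
IsUnion X s t u = ∀ w → s w ≡ (t w ∨ u w)

Empty : (X : List ℕ) → Team X → Set
Empty X s = ∀ w → s w ≡ false

NonEmpty : (X : List ℕ) → Team X → Set
NonEmpty X s = Σ (Val X) λ w → _∈T_ {X} w s

mutual
  sup : (X : List ℕ) → Form → Team X → Set
  sup X (var p)   s = ∀ w → _∈T_ {X} w s → val X w p ≡ true
  sup X bot       s = Empty X s
  sup X (neg φ)   s = anti X φ s
  sup X (φ and ψ) s = sup X φ s × sup X ψ s
  sup X (φ or ψ)  s = Σ (Team X) λ t → Σ (Team X) λ u →
                        IsUnion X s t u × sup X φ t × sup X ψ u
  sup X NE        s = NonEmpty X s

  anti : (X : List ℕ) → Form → Team X → Set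
  anti X (var p)   s = ∀ w → _∈T_ {X} w s → val X w p ≡ false
  anti X bot       s = ⊤
  anti X (neg φ)   s = sup X φ s
  anti X (φ and ψ) s = Σ (Team X) λ t → Σ (Team X) λ u →
                         IsUnion X s t u × anti X φ t × anti X ψ u
  anti X (φ or ψ)  s = anti X φ s × anti X ψ s
  anti X NE        s = Empty X s

Covers : List ℕ → Form → Form → Set
Covers X φ ψ = Unique X × P φ ⊆ X × P ψ ⊆ X

_≡F_ : Form → Form → Set
φ ≡F ψ = ∀ X → Covers X φ ψ → (s : Team X) → sup X φ s ⇔ sup X ψ s

Ground : (X : List ℕ) → Form → Val X → Set
Ground X φ w = Σ (Team X) λ s → sup X φ s × _∈T_ {X} w s

botNE : Form
botNE = bot and NE

GroundCompl : Form → Form → Set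
GroundCompl φ ψ =
  (∀ X → Covers X φ ψ → ∀ w →
      (Ground X φ w ⇔ (Ground X top w × ¬ Ground X ψ w))
    × (Ground X ψ w ⇔ (Ground X top w × ¬ Ground X φ w)))
  ⊎ (φ ≡F botNE)
  ⊎ (ψ ≡F botNE)

SameVars : Form → Form → Form → Set
SameVars θ φ ψ = ∀ p → p ∈ P θ ⇔ (p ∈ P φ ⊎ p ∈ P ψ)

-- Read NE as ⊤ to get the classical truth value eval A w of a formula.  Support
-- absorbs classical models: if s supports A and every valuation in t makes A
-- classically true, then s ∪ t supports A.  So the ground team of a satisfiable
-- formula is the set of its classical models, and for satisfiable φ and ψ
-- ground-complementarity says exactly that ψ is classically ¬φ.  In that case
-- θ = φ⁻ ∨ ¬ψ⁻ works, where A⁻ (flattenNeg A) replaces each NE under an odd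
-- number of negations by ⊤: this keeps the support of A but makes its
-- anti-support classical falsity.  An unsatisfiable φ is ≡ ⊥ ∧ NE and is
-- handled by θ = (⊥ ∧ NE ∧ …) ∨ ¬ψ.  Conversely, if θ and ¬θ are both
-- satisfiable, the ground teams of φ ≡ θ and ψ ≡ ¬θ are the complementary
-- classical extensions of θ and ¬θ.  Every case split is on satisfiability.  It
-- is decidable and independent of the variable set, because it can be computed
-- by recursion on the formula relative to a classical constraint.
module Submission where

open import Defs
open import Data.Bool using (Bool; true; false; not; _∧_; _∨_; _≟_; T)
open import Data.Bool.Properties
  using (∨-∧-booleanAlgebra; ∨-identityʳ; ∨-zeroʳ; ∨-comm; ∧-conicalˡ; ∧-conicalʳ; not-involutive;
         ¬-not)
open import Algebra.Lattice.Properties.BooleanAlgebra ∨-∧-booleanAlgebra using (deMorgan₁; deMorgan₂)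
open import Data.Empty using (⊥-elim)
open import Data.List using (List; []; _∷_; _++_; length; deduplicate)
open import Data.List.Membership.Propositional using (_∈_)
open import Data.List.Membership.Propositional.Properties
  using (∈-++⁺ˡ; ∈-++⁺ʳ; ∈-++⁻; ∈-deduplicate⁺)
open import Data.List.Relation.Binary.Subset.Propositional using (_⊆_)
open import Data.List.Relation.Unary.Any using (here; tail)
open import Data.List.Relation.Unary.Unique.Propositional using (Unique)
open import Data.Nat using (ℕ; zero; suc; _≡ᵇ_) renaming (_≟_ to _≟ℕ_)
open import Data.Nat.Properties using (≡ᵇ⇒≡; ≡⇒≡ᵇ)
open import Data.List.Relation.Unary.Unique.DecPropositional.Properties _≟ℕ_ using (deduplicate-!)
open import Data.Product using (Σ; Σ-syntax; ∃; _×_; _,_; proj₁; proj₂)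
open import Data.Product.Function.NonDependent.Propositional using (_×-⇔_)
open import Data.Sum using (_⊎_; inj₁; inj₂; [_,_]; swap)
open import Data.Unit using (⊤; tt)
open import Data.Vec using (Vec; []; _∷_)
open import Function using (_∘_)
open import Function.Bundles using (_⇔_; mk⇔; Equivalence)
open import Function.Construct.Composition using (_⇔-∘_)
open import Function.Construct.Identity using (⇔-id)
open import Function.Construct.Symmetry using (⇔-sym)
open import Relation.Nullary using (¬_; Dec; yes; no)
open import Relation.Nullary.Decidable using (map; _×-dec_; _⊎-dec_; decidable-stable)
open import Relation.Unary using (Decidable)
open import Relation.Binary.PropositionalEquality
  using (_≡_; _≢_; _≗_; refl; sym; trans; cong; cong₂; subst; module ≡-Reasoning)

open Equivalence using (to; from)

false≢true : false ≢ true
false≢true ()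

not≡true⇔≡false : ∀ b → not b ≡ true ⇔ b ≡ false
not≡true⇔≡false true  = mk⇔ (λ ()) (λ ())
not≡true⇔≡false false = mk⇔ (λ _ → refl) (λ _ → refl)

not≡true⇔≢true : ∀ b → not b ≡ true ⇔ b ≢ true
not≡true⇔≢true true  = mk⇔ (λ ()) (λ b≢true → ⊥-elim (b≢true refl))
not≡true⇔≢true false = mk⇔ (λ _ ()) (λ _ → refl)

∨≡true⁻ : ∀ a {b} → a ∨ b ≡ true → a ≡ true ⊎ b ≡ true
∨≡true⁻ true  _ = inj₁ refl
∨≡true⁻ false e = inj₂ e

∨-medial : ∀ a b c d → (a ∨ b) ∨ (c ∨ d) ≡ (a ∨ c) ∨ (b ∨ d)
∨-medial true  b     c d = refl
∨-medial false true  c d = sym (∨-zeroʳ c)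
∨-medial false false c d = refl

∧-split-∨ : ∀ a b → a ≡ (a ∧ b) ∨ (a ∧ not b)
∧-split-∨ true  true  = refl
∧-split-∨ true  false = refl
∧-split-∨ false b     = refl

∃-Vec? : ∀ n {P : Vec Bool n → Set} → Decidable P → Dec (∃ P)
∃-Vec? zero    P? = map (mk⇔ ([] ,_) λ { ([] , p) → p }) (P? [])
∃-Vec? (suc n) {P} P? =
  map (mk⇔ cons uncons) (∃-Vec? n (P? ∘ (true ∷_)) ⊎-dec ∃-Vec? n (P? ∘ (false ∷_)))
  where
  cons : ∃ (P ∘ (true ∷_)) ⊎ ∃ (P ∘ (false ∷_)) → ∃ P
  cons (inj₁ (v , p)) = true ∷ v , p
  cons (inj₂ (v , p)) = false ∷ v , p

  uncons : ∃ P → ∃ (P ∘ (true ∷_)) ⊎ ∃ (P ∘ (false ∷_))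
  uncons (true ∷ v , p)  = inj₁ (v , p)
  uncons (false ∷ v , p) = inj₂ (v , p)

mutual
  flattenNeg : Form → Form
  flattenNeg (var p)   = var p
  flattenNeg bot       = bot
  flattenNeg (neg A)   = neg (flattenPos A)
  flattenNeg (A and B) = flattenNeg A and flattenNeg B
  flattenNeg (A or B)  = flattenNeg A or flattenNeg B
  flattenNeg NE        = NE

  flattenPos : Form → Form
  flattenPos (var p)   = var p
  flattenPos bot       = bot
  flattenPos (neg A)   = neg (flattenNeg A)
  flattenPos (A and B) = flattenPos A and flattenPos B
  flattenPos (A or B)  = flattenPos A or flattenPos B
  flattenPos NE        = top

mutual
  P-flattenNeg : ∀ A → P (flattenNeg A) ≡ P A
  P-flattenNeg (var p)   = refl
  P-flattenNeg bot       = refl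
  P-flattenNeg (neg A)   = P-flattenPos A
  P-flattenNeg (A and B) = cong₂ _++_ (P-flattenNeg A) (P-flattenNeg B)
  P-flattenNeg (A or B)  = cong₂ _++_ (P-flattenNeg A) (P-flattenNeg B)
  P-flattenNeg NE        = refl

  P-flattenPos : ∀ A → P (flattenPos A) ≡ P A
  P-flattenPos (var p)   = refl
  P-flattenPos bot       = refl
  P-flattenPos (neg A)   = P-flattenNeg A
  P-flattenPos (A and B) = cong₂ _++_ (P-flattenPos A) (P-flattenPos B)
  P-flattenPos (A or B)  = cong₂ _++_ (P-flattenPos A) (P-flattenPos B)
  P-flattenPos NE        = refl

-- The argument only contributes its variables, so that P θ comes out right.
botNE-over : Form → Form
botNE-over A = botNE and neg (flattenPos A)

θ-unsatisfiable : Form → Form → Form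
θ-unsatisfiable φ ψ = botNE-over φ or neg ψ

θ-complementary : Form → Form → Form
θ-complementary φ ψ = flattenNeg φ or neg (flattenNeg ψ)

module _ (X : List ℕ) where

  ∅ : Team X
  ∅ _ = false

  _∪_ : Team X → Team X → Team X
  (s ∪ t) w = s w ∨ t w

  UnionOf : Team X → (Team X → Set) → (Team X → Set) → Set
  UnionOf s Q R = Σ[ t ∈ Team X ] Σ[ u ∈ Team X ] IsUnion X s t u × Q t × R u

  UnionOf-cong : ∀ {s Q Q′ R R′} → (∀ {t} → Q t ⇔ Q′ t) → (∀ {u} → R u ⇔ R′ u) →
                 UnionOf s Q R ⇔ UnionOf s Q′ R′
  UnionOf-cong Q⇔Q′ R⇔R′ = mk⇔ (λ (t , u , U , q , r) → t , u , U , to Q⇔Q′ q , to R⇔R′ r)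
                               (λ (t , u , U , q , r) → t , u , U , from Q⇔Q′ q , from R⇔R′ r)

  ∪-identityʳ : ∀ s → IsUnion X s s ∅
  ∪-identityʳ s w = sym (∨-identityʳ (s w))

  ∪-medial : ∀ {s t} s₁ s₂ t₁ t₂ → IsUnion X s s₁ s₂ → IsUnion X t t₁ t₂ →
             IsUnion X (s ∪ t) (s₁ ∪ t₁) (s₂ ∪ t₂)
  ∪-medial s₁ s₂ t₁ t₂ S T w =
    trans (cong₂ _∨_ (S w) (T w)) (∨-medial (s₁ w) (s₂ w) (t₁ w) (t₂ w))

  ∈-∪⁻ : ∀ {s} t u → IsUnion X s t u → ∀ {w} → s w ≡ true → t w ≡ true ⊎ u w ≡ true
  ∈-∪⁻ t u U {w} i = ∨≡true⁻ (t w) (trans (sym (U w)) i)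

  ∈-∪⁺ˡ : ∀ {s} t u → IsUnion X s t u → ∀ {w} → t w ≡ true → s w ≡ true
  ∈-∪⁺ˡ t u U {w} i = trans (U w) (cong (_∨ u w) i)

  ∈-∪⁺ʳ : ∀ {s} t u → IsUnion X s t u → ∀ {w} → u w ≡ true → s w ≡ true
  ∈-∪⁺ʳ t u U {w} i = trans (U w) (trans (cong (t w ∨_) i) (∨-zeroʳ (t w)))

  Empty-∪ : ∀ {s t} → Empty X s → Empty X t → Empty X (s ∪ t)
  Empty-∪ es et w = cong₂ _∨_ (es w) (et w)

  -- In negation normal form, so that eval (neg A) unfolds along the same
  -- clauses as anti-support.
  eval : Form → Val X → Bool
  eval (var p)         w = val X w p
  eval bot             w = false
  eval NE              w = true
  eval (A and B)       w = eval A w ∧ eval B w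
  eval (A or B)        w = eval A w ∨ eval B w
  eval (neg (var p))   w = not (val X w p)
  eval (neg bot)       w = true
  eval (neg NE)        w = false
  eval (neg (A and B)) w = eval (neg A) w ∨ eval (neg B) w
  eval (neg (A or B))  w = eval (neg A) w ∧ eval (neg B) w
  eval (neg (neg A))   w = eval A w

  eval-neg : ∀ A w → eval (neg A) w ≡ not (eval A w)
  eval-neg (var p)   w = refl
  eval-neg bot       w = refl
  eval-neg NE        w = refl
  eval-neg (A and B) w =
    trans (cong₂ _∨_ (eval-neg A w) (eval-neg B w)) (sym (deMorgan₁ (eval A w) (eval B w)))
  eval-neg (A or B)  w =
    trans (cong₂ _∧_ (eval-neg A w) (eval-neg B w)) (sym (deMorgan₂ (eval A w) (eval B w)))
  eval-neg (neg A)   w = sym (trans (cong not (eval-neg A w)) (not-involutive (eval A w)))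

  eval-neg≡true : ∀ A w → eval (neg A) w ≡ true ⇔ (eval A w ≢ true)
  eval-neg≡true A w rewrite eval-neg A w = not≡true⇔≢true (eval A w)

  TrueOn : Form → Team X → Set
  TrueOn A s = ∀ w → s w ≡ true → eval A w ≡ true

  TrueOn-always : ∀ A {s} → (∀ w → eval A w ≡ true) → ⊤ ⇔ TrueOn A s
  TrueOn-always A valid = mk⇔ (λ _ w _ → valid w) (λ _ → tt)

  TrueOn-never : ∀ A {s} → (∀ w → eval A w ≡ false) → TrueOn A s ⇔ Empty X s
  TrueOn-never A unsat = mk⇔
    (λ h w → ¬-not (λ i → false≢true (trans (sym (unsat w)) (h w i))))
    (λ e w i → ⊥-elim (false≢true (trans (sym (e w)) i)))

  TrueOn-neg-var : ∀ {p s} → TrueOn (neg (var p)) s ⇔ anti X (var p) s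
  TrueOn-neg-var {p} = mk⇔ (λ h w i → to (not≡true⇔≡false (val X w p)) (h w i))
                           (λ h w i → from (not≡true⇔≡false (val X w p)) (h w i))

  TrueOn-and : ∀ A B {s} → (TrueOn A s × TrueOn B s) ⇔ TrueOn (A and B) s
  TrueOn-and A B = mk⇔ (λ (hA , hB) w i → cong₂ _∧_ (hA w i) (hB w i))
                       (λ h → (λ w i → ∧-conicalˡ _ _ (h w i)) , (λ w i → ∧-conicalʳ _ _ (h w i)))

  TrueOn-or : ∀ A B {s} → UnionOf s (TrueOn A) (TrueOn B) ⇔ TrueOn (A or B) s
  TrueOn-or A B {s} = mk⇔ join split
    where
    join : UnionOf s (TrueOn A) (TrueOn B) → TrueOn (A or B) s
    join (t , u , U , hA , hB) w i with ∈-∪⁻ t u U i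
    ... | inj₁ j = cong (_∨ eval B w) (hA w j)
    ... | inj₂ j = trans (cong (eval A w ∨_) (hB w j)) (∨-zeroʳ (eval A w))

    B-true : TrueOn (A or B) s → ∀ w → s w ≡ true → eval A w ≡ false → eval B w ≡ true
    B-true h w i A-false = trans (sym (cong (_∨ eval B w) A-false)) (h w i)

    split : TrueOn (A or B) s → UnionOf s (TrueOn A) (TrueOn B)
    split h = (λ w → s w ∧ eval A w) , (λ w → s w ∧ not (eval A w)) ,
              (λ w → ∧-split-∨ (s w) (eval A w)) ,
              (λ w i → ∧-conicalʳ _ _ i) ,
              (λ w i → B-true h w (∧-conicalˡ _ _ i) (to (not≡true⇔≡false _) (∧-conicalʳ _ _ i)))

  TrueOn-∪ : ∀ A {s t} → TrueOn A s → TrueOn A t → TrueOn A (s ∪ t)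
  TrueOn-∪ A hs ht w i = [ hs w , ht w ] (∨≡true⁻ _ i)

  TrueOn-⊆ : ∀ A {s} t u → IsUnion X s t u → TrueOn A s → TrueOn A t × TrueOn A u
  TrueOn-⊆ A t u U h = (λ w i → h w (∈-∪⁺ˡ t u U i)) , (λ w i → h w (∈-∪⁺ʳ t u U i))

  sup-resp : ∀ A {s s′} → s ≗ s′ → sup X A s → sup X A s′
  sup-resp (var p)         e h w i                 = h w (trans (e w) i)
  sup-resp bot             e h w                   = trans (sym (e w)) (h w)
  sup-resp NE              e (w , i)               = w , trans (sym (e w)) i
  sup-resp (A and B)       e (hA , hB)             = sup-resp A e hA , sup-resp B e hB
  sup-resp (A or B)        e (t , u , U , hA , hB) = t , u , (λ w → trans (sym (e w)) (U w)) , hA , hB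
  sup-resp (neg (var p))   e h w i                 = h w (trans (e w) i)
  sup-resp (neg bot)       e _                     = tt
  sup-resp (neg NE)        e h w                   = trans (sym (e w)) (h w)
  sup-resp (neg (A and B)) e (t , u , U , hA , hB) = t , u , (λ w → trans (sym (e w)) (U w)) , hA , hB
  sup-resp (neg (A or B))  e (hA , hB)             = sup-resp (neg A) e hA , sup-resp (neg B) e hB
  sup-resp (neg (neg A))   e h                     = sup-resp A e h

  sup⇒TrueOn : ∀ A {s} → sup X A s → TrueOn A s
  sup⇒TrueOn (var p)         h           = h
  sup⇒TrueOn bot             h           = from (TrueOn-never bot λ _ → refl) h
  sup⇒TrueOn NE              _           = λ _ _ → refl
  sup⇒TrueOn (A and B)       (hA , hB)   = to (TrueOn-and A B) (sup⇒TrueOn A hA , sup⇒TrueOn B hB)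
  sup⇒TrueOn (A or B)        (t , u , U , hA , hB) =
    to (TrueOn-or A B) (t , u , U , sup⇒TrueOn A hA , sup⇒TrueOn B hB)
  sup⇒TrueOn (neg (var p))   h           = from TrueOn-neg-var h
  sup⇒TrueOn (neg bot)       _           = λ _ _ → refl
  sup⇒TrueOn (neg NE)        h           = from (TrueOn-never (neg NE) λ _ → refl) h
  sup⇒TrueOn (neg (A and B)) (t , u , U , hA , hB) =
    to (TrueOn-or (neg A) (neg B)) (t , u , U , sup⇒TrueOn (neg A) hA , sup⇒TrueOn (neg B) hB)
  sup⇒TrueOn (neg (A or B))  (hA , hB)   =
    to (TrueOn-and (neg A) (neg B)) (sup⇒TrueOn (neg A) hA , sup⇒TrueOn (neg B) hB)
  sup⇒TrueOn (neg (neg A))   h           = sup⇒TrueOn A h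

  Absorbs : Form → Set
  Absorbs A = ∀ {s t} → sup X A s → TrueOn A t → sup X A (s ∪ t)

  absorbs-and : ∀ A B → Absorbs A → Absorbs B → Absorbs (A and B)
  absorbs-and A B absA absB (hA , hB) h =
    let (tA , tB) = from (TrueOn-and A B) h in absA hA tA , absB hB tB

  absorbs-or : ∀ A B → Absorbs A → Absorbs B → Absorbs (A or B)
  absorbs-or A B absA absB (s₁ , s₂ , S , hA , hB) h =
    let (t₁ , t₂ , T , tA , tB) = from (TrueOn-or A B) h
    in s₁ ∪ t₁ , s₂ ∪ t₂ , ∪-medial s₁ s₂ t₁ t₂ S T , absA hA tA , absB hB tB

  absorbs : ∀ A → Absorbs A
  absorbs (var p)         = TrueOn-∪ (var p)
  absorbs bot             = λ h h′ → Empty-∪ h (to (TrueOn-never bot λ _ → refl) h′)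
  absorbs NE              = λ (w , i) _ → w , cong (_∨ _) i
  absorbs (A and B)       = absorbs-and A B (absorbs A) (absorbs B)
  absorbs (A or B)        = absorbs-or A B (absorbs A) (absorbs B)
  absorbs (neg (var p))   =
    λ h h′ → to TrueOn-neg-var (TrueOn-∪ (neg (var p)) (from TrueOn-neg-var h) h′)
  absorbs (neg bot)       = λ _ _ → tt
  absorbs (neg NE)        = λ h h′ → Empty-∪ h (to (TrueOn-never (neg NE) λ _ → refl) h′)
  absorbs (neg (A and B)) = absorbs-or (neg A) (neg B) (absorbs (neg A)) (absorbs (neg B))
  absorbs (neg (A or B))  = absorbs-and (neg A) (neg B) (absorbs (neg A)) (absorbs (neg B))
  absorbs (neg (neg A))   = absorbs A

  mutual
    sup-flattenNeg : ∀ A {s} → sup X (flattenNeg A) s ⇔ sup X A s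
    sup-flattenNeg (var p)   = ⇔-id _
    sup-flattenNeg bot       = ⇔-id _
    sup-flattenNeg (neg A)   = anti-flattenPos A
    sup-flattenNeg (A and B) = sup-flattenNeg A ×-⇔ sup-flattenNeg B
    sup-flattenNeg (A or B)  = UnionOf-cong (sup-flattenNeg A) (sup-flattenNeg B)
    sup-flattenNeg NE        = ⇔-id _

    anti-flattenNeg : ∀ A {s} → anti X (flattenNeg A) s ⇔ TrueOn (neg A) s
    anti-flattenNeg (var p)   = ⇔-sym TrueOn-neg-var
    anti-flattenNeg bot       = TrueOn-always (neg bot) λ _ → refl
    anti-flattenNeg (neg A)   = sup-flattenPos A
    anti-flattenNeg (A and B) =
      TrueOn-or (neg A) (neg B) ⇔-∘ UnionOf-cong (anti-flattenNeg A) (anti-flattenNeg B)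
    anti-flattenNeg (A or B)  = TrueOn-and (neg A) (neg B) ⇔-∘ (anti-flattenNeg A ×-⇔ anti-flattenNeg B)
    anti-flattenNeg NE        = ⇔-sym (TrueOn-never (neg NE) λ _ → refl)

    sup-flattenPos : ∀ A {s} → sup X (flattenPos A) s ⇔ TrueOn A s
    sup-flattenPos (var p)   = ⇔-id _
    sup-flattenPos bot       = ⇔-sym (TrueOn-never bot λ _ → refl)
    sup-flattenPos (neg A)   = anti-flattenNeg A
    sup-flattenPos (A and B) = TrueOn-and A B ⇔-∘ (sup-flattenPos A ×-⇔ sup-flattenPos B)
    sup-flattenPos (A or B)  = TrueOn-or A B ⇔-∘ UnionOf-cong (sup-flattenPos A) (sup-flattenPos B)
    sup-flattenPos NE        = TrueOn-always NE λ _ → refl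

    anti-flattenPos : ∀ A {s} → anti X (flattenPos A) s ⇔ anti X A s
    anti-flattenPos (var p)   = ⇔-id _
    anti-flattenPos bot       = ⇔-id _
    anti-flattenPos (neg A)   = sup-flattenNeg A
    anti-flattenPos (A and B) = UnionOf-cong (anti-flattenPos A) (anti-flattenPos B)
    anti-flattenPos (A or B)  = anti-flattenPos A ×-⇔ anti-flattenPos B
    anti-flattenPos NE        = ⇔-id _

  SatisfiableIn : Form → Form → Set
  SatisfiableIn γ A = Σ[ s ∈ Team X ] sup X A s × TrueOn γ s

  satisfiableIn-∅ : ∀ γ A → sup X A ∅ → SatisfiableIn γ A
  satisfiableIn-∅ γ A h = ∅ , h , λ _ ()

  satisfiableIn-NE : ∀ γ → (∃ λ w → eval γ w ≡ true) ⇔ SatisfiableIn γ NE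
  satisfiableIn-NE γ = mk⇔ (λ (w , e) → eval γ , (w , e) , λ _ i → i)
                           (λ (s , (w , i) , g) → w , g w i)

  -- Each team lies inside the classical models of the other conjunct, so their
  -- union still supports both by absorption.
  satisfiableIn-and : ∀ γ A B →
    (SatisfiableIn (γ and B) A × SatisfiableIn (γ and A) B) ⇔ SatisfiableIn γ (A and B)
  satisfiableIn-and γ A B = mk⇔ join split
    where
    join : SatisfiableIn (γ and B) A × SatisfiableIn (γ and A) B → SatisfiableIn γ (A and B)
    join ((s , hA , gs) , (t , hB , gt)) =
      let (γs , Bs) = from (TrueOn-and γ B) gs
          (γt , At) = from (TrueOn-and γ A) gt
      in s ∪ t ,
         (absorbs A hA At , sup-resp B (λ w → ∨-comm (t w) (s w)) (absorbs B hB Bs)) ,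
         TrueOn-∪ γ γs γt

    split : SatisfiableIn γ (A and B) → SatisfiableIn (γ and B) A × SatisfiableIn (γ and A) B
    split (s , (hA , hB) , g) = (s , hA , to (TrueOn-and γ B) (g , sup⇒TrueOn B hB)) ,
                                (s , hB , to (TrueOn-and γ A) (g , sup⇒TrueOn A hA))

  satisfiableIn-or : ∀ γ A B → (SatisfiableIn γ A × SatisfiableIn γ B) ⇔ SatisfiableIn γ (A or B)
  satisfiableIn-or γ A B = mk⇔
    (λ ((t , hA , gt) , (u , hB , gu)) →
       t ∪ u , (t , u , (λ _ → refl) , hA , hB) , TrueOn-∪ γ gt gu)
    (λ (s , (t , u , U , hA , hB) , g) →
       let (gt , gu) = TrueOn-⊆ γ t u U g in (t , hA , gt) , (u , hB , gu))

  satisfiableIn? : ∀ γ A → Dec (SatisfiableIn γ A)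
  satisfiableIn? γ (var p)         = yes (satisfiableIn-∅ γ (var p) λ _ ())
  satisfiableIn? γ bot             = yes (satisfiableIn-∅ γ bot λ _ → refl)
  satisfiableIn? γ NE              = map (satisfiableIn-NE γ) (∃-Vec? (length X) λ w → eval γ w ≟ true)
  satisfiableIn? γ (A and B)       =
    map (satisfiableIn-and γ A B) (satisfiableIn? (γ and B) A ×-dec satisfiableIn? (γ and A) B)
  satisfiableIn? γ (A or B)        =
    map (satisfiableIn-or γ A B) (satisfiableIn? γ A ×-dec satisfiableIn? γ B)
  satisfiableIn? γ (neg (var p))   = yes (satisfiableIn-∅ γ (neg (var p)) λ _ ())
  satisfiableIn? γ (neg bot)       = yes (satisfiableIn-∅ γ (neg bot) tt)
  satisfiableIn? γ (neg NE)        = yes (satisfiableIn-∅ γ (neg NE) λ _ → refl)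
  satisfiableIn? γ (neg (A and B)) =
    map (satisfiableIn-or γ (neg A) (neg B)) (satisfiableIn? γ (neg A) ×-dec satisfiableIn? γ (neg B))
  satisfiableIn? γ (neg (A or B))  =
    map (satisfiableIn-and γ (neg A) (neg B))
        (satisfiableIn? (γ and neg B) (neg A) ×-dec satisfiableIn? (γ and neg A) (neg B))
  satisfiableIn? γ (neg (neg A))   = satisfiableIn? γ A

  Satisfiable : Form → Set
  Satisfiable A = Σ (Team X) (sup X A)

  Satisfiable⇔SatisfiableIn-top : ∀ A → Satisfiable A ⇔ SatisfiableIn top A
  Satisfiable⇔SatisfiableIn-top A = mk⇔ (λ (s , h) → s , h , λ _ _ → refl) (λ (s , h , _) → s , h)

  ground⇔eval : ∀ A → Satisfiable A → ∀ w → Ground X A w ⇔ eval A w ≡ true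
  ground⇔eval A (s₀ , h₀) w = mk⇔
    (λ (s , h , i) → sup⇒TrueOn A h w i)
    (λ e → s₀ ∪ eval A , absorbs A h₀ (λ _ i → i) , trans (cong (s₀ w ∨_) e) (∨-zeroʳ (s₀ w)))

  Ground-cong : ∀ A B → (∀ s → sup X A s ⇔ sup X B s) → ∀ w → Ground X A w ⇔ Ground X B w
  Ground-cong A B A⇔B w =
    mk⇔ (λ (s , h , i) → s , to (A⇔B s) h , i) (λ (s , h , i) → s , from (A⇔B s) h , i)

  ground-top : ∀ w → Ground X top w
  ground-top w = (λ _ → true) , tt , refl

  botNE-unsupported : ∀ {s} → ¬ sup X botNE s
  botNE-unsupported (empty , w , i) = false≢true (trans (sym (empty w)) i)

  anti-botNE-over : ∀ A {s} → anti X (botNE-over A) s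
  anti-botNE-over A {s} =
    s , ∅ , ∪-identityʳ s , (s , ∅ , ∪-identityʳ s , tt , λ _ → refl) ,
    from (sup-flattenPos A) λ _ ()

  sup-θ-unsatisfiable : ∀ φ ψ {s} → ¬ Satisfiable φ →
    sup X φ s ⇔ sup X (θ-unsatisfiable φ ψ) s
  sup-θ-unsatisfiable φ ψ unsat = mk⇔ (λ h → ⊥-elim (unsat (_ , h)))
                                      (λ (_ , _ , _ , (h , _) , _) → ⊥-elim (botNE-unsupported h))

  anti-θ-unsatisfiable : ∀ φ ψ {s} → sup X ψ s ⇔ anti X (θ-unsatisfiable φ ψ) s
  anti-θ-unsatisfiable φ ψ = mk⇔ (λ h → anti-botNE-over φ , h) proj₂

  Complementary : Form → Form → Set
  Complementary φ ψ = ∀ w → eval φ w ≡ true ⇔ (eval ψ w ≢ true)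

  sup-θ-complementary : ∀ φ ψ {s} → Complementary φ ψ →
    sup X φ s ⇔ sup X (θ-complementary φ ψ) s
  sup-θ-complementary φ ψ {s} compl = mk⇔
    (λ h → s , ∅ , ∪-identityʳ s , from (sup-flattenNeg φ) h , from (anti-flattenNeg ψ) λ _ ())
    (λ (t , u , U , hφ , hψ) →
       sup-resp φ (sym ∘ U) (absorbs φ (to (sup-flattenNeg φ) hφ) (φ-true-on u hψ)))
    where
    φ-true-on : ∀ u → anti X (flattenNeg ψ) u → TrueOn φ u
    φ-true-on u hψ w i = from (compl w) (to (eval-neg≡true ψ w) (to (anti-flattenNeg ψ) hψ w i))

  anti-θ-complementary : ∀ φ ψ {s} → Complementary φ ψ →
    sup X ψ s ⇔ anti X (θ-complementary φ ψ) s
  anti-θ-complementary φ ψ {s} compl = mk⇔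
    (λ h → from (anti-flattenNeg φ) (φ-false-on h) , from (sup-flattenNeg ψ) h)
    (λ (_ , h) → to (sup-flattenNeg ψ) h)
    where
    φ-false-on : sup X ψ s → TrueOn (neg φ) s
    φ-false-on h w i =
      from (eval-neg≡true φ w) λ φ-true → to (compl w) φ-true (sup⇒TrueOn ψ h w i)

  Complementary-from-ground : ∀ φ ψ → Satisfiable φ → Satisfiable ψ →
    (∀ w → Ground X φ w ⇔ (Ground X top w × ¬ Ground X ψ w)) → Complementary φ ψ
  Complementary-from-ground φ ψ sφ sψ compl w = mk⇔
    (λ φ-true ψ-true → proj₂ (to (compl w) (from gφ φ-true)) (from gψ ψ-true))
    (λ ψ-false → to gφ (from (compl w) (ground-top w , ψ-false ∘ to gψ)))
    where
    gφ : Ground X φ w ⇔ eval φ w ≡ true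
    gφ = ground⇔eval φ sφ w
    gψ : Ground X ψ w ⇔ eval ψ w ≡ true
    gψ = ground⇔eval ψ sψ w

  ground-complement : ∀ φ ψ θ → Satisfiable θ → Satisfiable (neg θ) →
    (∀ s → sup X φ s ⇔ sup X θ s) → (∀ s → sup X ψ s ⇔ anti X θ s) →
    ∀ w → Ground X φ w ⇔ (Ground X top w × ¬ Ground X ψ w)
  ground-complement φ ψ θ sθ s¬θ φ⇔θ ψ⇔¬θ w = mk⇔
    (λ g → ground-top w , λ g′ → to (eval-neg≡true θ w) (to gψ g′) (to gφ g))
    (λ (_ , ¬g) → from gφ (decidable-stable (eval θ w ≟ true) λ θ-false →
                            ¬g (from gψ (from (eval-neg≡true θ w) θ-false))))
    where
    gφ : Ground X φ w ⇔ eval θ w ≡ true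
    gφ = ground⇔eval θ sθ w ⇔-∘ Ground-cong φ θ φ⇔θ w
    gψ : Ground X ψ w ⇔ eval (neg θ) w ≡ true
    gψ = ground⇔eval (neg θ) s¬θ w ⇔-∘ Ground-cong ψ (neg θ) ψ⇔¬θ w

valuation : (Y : List ℕ) → (ℕ → Bool) → Val Y
valuation []      f = []
valuation (y ∷ Y) f = f y ∷ valuation Y f

-- The test does (y ≟ p) in val computes to y ≡ᵇ p, so that is what we case on.
val-valuation : ∀ Y f {p} → p ∈ Y → val Y (valuation Y f) p ≡ f p
val-valuation (y ∷ Y) f {p} i with y ≡ᵇ p in y≡ᵇp
... | true  = cong f (≡ᵇ⇒≡ y p (subst T (sym y≡ᵇp) tt))
... | false = val-valuation Y f (tail (λ p≡y → subst T y≡ᵇp (≡⇒≡ᵇ y p (sym p≡y))) i)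

eval-local : ∀ X Y A {w w′} → (∀ {p} → p ∈ P A → val Y w′ p ≡ val X w p) → eval Y A w′ ≡ eval X A w
eval-local X Y (var p)   agree = agree (here refl)
eval-local X Y bot       agree = refl
eval-local X Y NE        agree = refl
eval-local X Y (A and B) agree =
  cong₂ _∧_ (eval-local X Y A λ i → agree (∈-++⁺ˡ i))
            (eval-local X Y B λ i → agree (∈-++⁺ʳ (P A) i))
eval-local X Y (A or B)  agree =
  cong₂ _∨_ (eval-local X Y A λ i → agree (∈-++⁺ˡ i))
            (eval-local X Y B λ i → agree (∈-++⁺ʳ (P A) i))
eval-local X Y (neg A) {w} {w′} agree = begin
  eval Y (neg A) w′  ≡⟨ eval-neg Y A w′ ⟩
  not (eval Y A w′)  ≡⟨ cong not (eval-local X Y A agree) ⟩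
  not (eval X A w)   ≡⟨ eval-neg X A w ⟨
  eval X (neg A) w   ∎
  where open ≡-Reasoning

++-⊆⁻ : ∀ {xs ys zs : List ℕ} → xs ++ ys ⊆ zs → xs ⊆ zs × ys ⊆ zs
++-⊆⁻ {xs} sub = (λ i → sub (∈-++⁺ˡ i)) , (λ i → sub (∈-++⁺ʳ xs i))

++-⊆⁺ : ∀ {xs ys zs : List ℕ} → xs ⊆ zs → ys ⊆ zs → xs ++ ys ⊆ zs
++-⊆⁺ {xs} xs⊆ ys⊆ i = [ xs⊆ , ys⊆ ] (∈-++⁻ xs i)

satisfiableIn-transfer : ∀ X Y γ A → P γ ⊆ Y → P A ⊆ Y → SatisfiableIn X γ A → SatisfiableIn Y γ A
satisfiableIn-transfer X Y γ (var p)         _  _   _ = satisfiableIn-∅ Y γ (var p) λ _ ()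
satisfiableIn-transfer X Y γ bot             _  _   _ = satisfiableIn-∅ Y γ bot λ _ → refl
satisfiableIn-transfer X Y γ NE              γ⊆ _   h =
  let (w , e) = from (satisfiableIn-NE X γ) h
      agree = λ {p} (i : p ∈ P γ) → val-valuation Y (val X w) (γ⊆ i)
  in to (satisfiableIn-NE Y γ) (valuation Y (val X w) , trans (eval-local X Y γ agree) e)
satisfiableIn-transfer X Y γ (A and B)       γ⊆ AB⊆ h =
  let (A⊆ , B⊆) = ++-⊆⁻ AB⊆
      (hA , hB) = from (satisfiableIn-and X γ A B) h
  in to (satisfiableIn-and Y γ A B)
        (satisfiableIn-transfer X Y (γ and B) A (++-⊆⁺ γ⊆ B⊆) A⊆ hA ,
         satisfiableIn-transfer X Y (γ and A) B (++-⊆⁺ γ⊆ A⊆) B⊆ hB)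
satisfiableIn-transfer X Y γ (A or B)        γ⊆ AB⊆ h =
  let (A⊆ , B⊆) = ++-⊆⁻ AB⊆
      (hA , hB) = from (satisfiableIn-or X γ A B) h
  in to (satisfiableIn-or Y γ A B)
        (satisfiableIn-transfer X Y γ A γ⊆ A⊆ hA ,
         satisfiableIn-transfer X Y γ B γ⊆ B⊆ hB)
satisfiableIn-transfer X Y γ (neg (var p))   _  _   _ = satisfiableIn-∅ Y γ (neg (var p)) λ _ ()
satisfiableIn-transfer X Y γ (neg bot)       _  _   _ = satisfiableIn-∅ Y γ (neg bot) tt
satisfiableIn-transfer X Y γ (neg NE)        _  _   _ = satisfiableIn-∅ Y γ (neg NE) λ _ → refl
satisfiableIn-transfer X Y γ (neg (A and B)) γ⊆ AB⊆ h =
  let (A⊆ , B⊆) = ++-⊆⁻ AB⊆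
      (hA , hB) = from (satisfiableIn-or X γ (neg A) (neg B)) h
  in to (satisfiableIn-or Y γ (neg A) (neg B))
        (satisfiableIn-transfer X Y γ (neg A) γ⊆ A⊆ hA ,
         satisfiableIn-transfer X Y γ (neg B) γ⊆ B⊆ hB)
satisfiableIn-transfer X Y γ (neg (A or B))  γ⊆ AB⊆ h =
  let (A⊆ , B⊆) = ++-⊆⁻ AB⊆
      (hA , hB) = from (satisfiableIn-and X γ (neg A) (neg B)) h
  in to (satisfiableIn-and Y γ (neg A) (neg B))
        (satisfiableIn-transfer X Y (γ and neg B) (neg A) (++-⊆⁺ γ⊆ B⊆) A⊆ hA ,
         satisfiableIn-transfer X Y (γ and neg A) (neg B) (++-⊆⁺ γ⊆ A⊆) B⊆ hB)
satisfiableIn-transfer X Y γ (neg (neg A))   γ⊆ A⊆  h = satisfiableIn-transfer X Y γ A γ⊆ A⊆ h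

satisfiable? : ∀ X A → Dec (Satisfiable X A)
satisfiable? X A = map (⇔-sym (Satisfiable⇔SatisfiableIn-top X A)) (satisfiableIn? X top A)

satisfiable-transfer : ∀ X Y A → P A ⊆ Y → Satisfiable X A → Satisfiable Y A
satisfiable-transfer X Y A A⊆ =
  from (Satisfiable⇔SatisfiableIn-top Y A) ∘ satisfiableIn-transfer X Y top A (λ ()) A⊆ ∘
  to (Satisfiable⇔SatisfiableIn-top X A)

covering : ∀ φ θ → Σ[ Y ∈ List ℕ ] Covers Y φ θ
covering φ θ = deduplicate _≟ℕ_ (P φ ++ P θ) , deduplicate-! (P φ ++ P θ) ,
               (λ i → ∈-deduplicate⁺ _≟ℕ_ (∈-++⁺ˡ i)) ,
               (λ i → ∈-deduplicate⁺ _≟ℕ_ (∈-++⁺ʳ (P φ) i))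

Represents : Form → Form → Form → Set
Represents φ ψ θ = (φ ≡F θ) × (ψ ≡F neg θ) × SameVars θ φ ψ

sameVars-++ : ∀ θ φ ψ → P θ ≡ P φ ++ P ψ → SameVars θ φ ψ
sameVars-++ θ φ ψ eq p rewrite eq = mk⇔ (∈-++⁻ (P φ)) [ ∈-++⁺ˡ , ∈-++⁺ʳ (P φ) ]

sameVars-⊆ : ∀ θ φ ψ {X} → SameVars θ φ ψ → P φ ⊆ X → P ψ ⊆ X → P θ ⊆ X
sameVars-⊆ θ φ ψ sv φ⊆ ψ⊆ i = [ φ⊆ , ψ⊆ ] (to (sv _) i)

represents : ∀ φ ψ θ → SameVars θ φ ψ →
  (∀ X → Covers X φ ψ → ∀ s → (sup X φ s ⇔ sup X θ s) × (sup X ψ s ⇔ anti X θ s)) →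
  Represents φ ψ θ
represents φ ψ θ sv r =
  (λ X (u , φ⊆ , θ⊆) s → proj₁ (r X (u , φ⊆ , λ i → θ⊆ (from (sv _) (inj₂ i))) s)) ,
  (λ X (u , ψ⊆ , θ⊆) s → proj₂ (r X (u , (λ i → θ⊆ (from (sv _) (inj₁ i))) , ψ⊆) s)) ,
  sv

represents-swap : ∀ φ ψ θ → Represents φ ψ θ → Represents ψ φ (neg θ)
represents-swap φ ψ θ (φ≡θ , ψ≡¬θ , sv) = ψ≡¬θ , φ≡θ , λ p → mk⇔ swap swap ⇔-∘ sv p

represents-unsatisfiableˡ : ∀ φ ψ → (∀ X → Unique X → P φ ⊆ X → ¬ Satisfiable X φ) →
  Represents φ ψ (θ-unsatisfiable φ ψ)
represents-unsatisfiableˡ φ ψ unsat =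
  represents φ ψ θ (sameVars-++ θ φ ψ (cong (_++ P ψ) (P-flattenPos φ))) λ X (u , φ⊆ , _) s →
    sup-θ-unsatisfiable X φ ψ (unsat X u φ⊆) , anti-θ-unsatisfiable X φ ψ
  where
  θ : Form
  θ = θ-unsatisfiable φ ψ

represents-unsatisfiableʳ : ∀ φ ψ → (∀ X → Unique X → P ψ ⊆ X → ¬ Satisfiable X ψ) →
  Represents φ ψ (neg (θ-unsatisfiable ψ φ))
represents-unsatisfiableʳ φ ψ unsat =
  represents-swap ψ φ (θ-unsatisfiable ψ φ) (represents-unsatisfiableˡ ψ φ unsat)

represents-complementary : ∀ φ ψ → (∀ X → Covers X φ ψ → Complementary X φ ψ) →
  Represents φ ψ (θ-complementary φ ψ)
represents-complementary φ ψ compl =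
  represents φ ψ (θ-complementary φ ψ)
    (sameVars-++ (θ-complementary φ ψ) φ ψ (cong₂ _++_ (P-flattenNeg φ) (P-flattenNeg ψ)))
    λ X cov s → sup-θ-complementary X φ ψ (compl X cov) , anti-θ-complementary X φ ψ (compl X cov)

≡botNE⇒unsatisfiable : ∀ φ → φ ≡F botNE → ∀ X → Unique X → P φ ⊆ X → ¬ Satisfiable X φ
≡botNE⇒unsatisfiable φ φ≡⊥ X u φ⊆ (s , h) = botNE-unsupported X (to (φ≡⊥ X (u , φ⊆ , λ ()) s) h)

represented-unsatisfiable⇒≡botNE : ∀ φ ψ θ → Represents φ ψ θ → ¬ Satisfiable (P θ) θ → φ ≡F botNE
represented-unsatisfiable⇒≡botNE φ ψ θ (φ≡θ , _ , _) unsat X (_ , φ⊆ , _) s with covering φ θ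
... | Y , Y-covers@(_ , φ⊆Y , _) =
  mk⇔ (λ h → ⊥-elim (unsat (satisfiable-transfer Y (P θ) θ (λ i → i) (θ-satisfiable h))))
      (λ h → ⊥-elim (botNE-unsupported X h))
  where
  θ-satisfiable : sup X φ s → Satisfiable Y θ
  θ-satisfiable h = let (t , h′) = satisfiable-transfer X Y φ φ⊆Y (s , h)
                    in t , to (φ≡θ Y Y-covers t) h′

groundCompl⇒represented : ∀ φ ψ → GroundCompl φ ψ → Σ Form (Represents φ ψ)
groundCompl⇒represented φ ψ (inj₂ (inj₁ φ≡⊥)) =
  θ-unsatisfiable φ ψ , represents-unsatisfiableˡ φ ψ (≡botNE⇒unsatisfiable φ φ≡⊥)
groundCompl⇒represented φ ψ (inj₂ (inj₂ ψ≡⊥)) =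
  neg (θ-unsatisfiable ψ φ) , represents-unsatisfiableʳ φ ψ (≡botNE⇒unsatisfiable ψ ψ≡⊥)
groundCompl⇒represented φ ψ (inj₁ compl) with satisfiable? (P φ ++ P ψ) φ | satisfiable? (P φ ++ P ψ) ψ
... | no ¬sφ | _ =
  θ-unsatisfiable φ ψ , represents-unsatisfiableˡ φ ψ λ X _ φ⊆ sφ →
    ¬sφ (satisfiable-transfer X (P φ ++ P ψ) φ (λ i → ∈-++⁺ˡ i) sφ)
... | _ | no ¬sψ =
  neg (θ-unsatisfiable ψ φ) , represents-unsatisfiableʳ φ ψ λ X _ ψ⊆ sψ →
    ¬sψ (satisfiable-transfer X (P φ ++ P ψ) ψ (λ i → ∈-++⁺ʳ (P φ) i) sψ)
... | yes sφ | yes sψ =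
  θ-complementary φ ψ , represents-complementary φ ψ λ X cov@(_ , φ⊆ , ψ⊆) →
    Complementary-from-ground X φ ψ (satisfiable-transfer (P φ ++ P ψ) X φ φ⊆ sφ)
      (satisfiable-transfer (P φ ++ P ψ) X ψ ψ⊆ sψ) (proj₁ ∘ compl X cov)

represented⇒groundCompl : ∀ φ ψ → Σ Form (Represents φ ψ) → GroundCompl φ ψ
represented⇒groundCompl φ ψ (θ , r) with satisfiable? (P θ) θ | satisfiable? (P θ) (neg θ)
... | no ¬sθ  | _ = inj₂ (inj₁ (represented-unsatisfiable⇒≡botNE φ ψ θ r ¬sθ))
... | _ | no ¬s¬θ =
  inj₂ (inj₂ (represented-unsatisfiable⇒≡botNE ψ φ (neg θ) (represents-swap φ ψ θ r) ¬s¬θ))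
... | yes sθ | yes s¬θ = inj₁ λ X (u , φ⊆ , ψ⊆) w →
  let (φ≡θ , ψ≡¬θ , sv) = r
      θ⊆ = sameVars-⊆ θ φ ψ sv φ⊆ ψ⊆
      sθ′ = satisfiable-transfer (P θ) X θ θ⊆ sθ
      s¬θ′ = satisfiable-transfer (P θ) X (neg θ) θ⊆ s¬θ
      φ⇔θ = φ≡θ X (u , φ⊆ , θ⊆)
      ψ⇔¬θ = ψ≡¬θ X (u , ψ⊆ , θ⊆)
  in ground-complement X φ ψ θ sθ′ s¬θ′ φ⇔θ ψ⇔¬θ w ,
     ground-complement X ψ φ (neg θ) s¬θ′ sθ′ ψ⇔¬θ φ⇔θ w

theorem3p23 : (φ ψ : Form) →
    GroundCompl φ ψ ⇔ Σ Form (λ θ → (φ ≡F θ) × (ψ ≡F neg θ) × SameVars θ φ ψ)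
theorem3p23 φ ψ = mk⇔ (groundCompl⇒represented φ ψ) (represented⇒groundCompl φ ψ)
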